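{- Let $r\in\mathbb{Z}_3$ satisfy $\left(\frac{r}{3}\right)=1$. If $(a,b,c)\in\mathbb{Z}_3^3$ is such that $ab+r$, $bc+r$ and $ac+r$ all lie in $\square(\mathbb{Z}_3)$, then at least one of $a,b,c$ is congruent to $0$ modulo $3$.
   Context: $\square(\mathbb{Z}_3)=\{x^2:x\in\mathbb{Z}_3\}$; $\left(\frac{\cdot}{3}\right)$ is the Legendre symbol applied via reduction modulo $3$. -}

module Defs where

open import Data.Nat using (ℕ; zero; suc; _+_; _*_; _^_; _<_; NonZero)
open import Data.Nat.Properties using (m^n≢0)
open import Data.Nat.DivMod using (_%_; m%n<n; m∣n⇒o%n%m≡o%m; %-distribˡ-+; %-distribˡ-*)
open import Data.Nat.Divisibility using (_∣_; divides)
open import Data.Integer using (ℤ; +_; -[1+_])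
open import Data.Product using (Σ)
open import Relation.Binary.PropositionalEquality
  using (_≡_; refl; trans; cong₂; sym)

nz : ∀ n → NonZero (3 ^ n)
nz n = m^n≢0 3 n

_mod3^_ : ℕ → ℕ → ℕ
m mod3^ n = _%_ m (3 ^ n) {{nz n}}
infixl 7 _mod3^_

3^n∣3^suc : ∀ n → 3 ^ n ∣ 3 ^ suc n
3^n∣3^suc n = divides 3 refl

-- The 3-adic integers ℤ₃ = lim ℤ/3^n ℤ, as compatible systems of residues:
-- res n ∈ {0,…,3^n-1} is the reduction modulo 3^n.
record ℤ₃ : Set where
  constructor mkℤ₃
  field
    res     : ℕ → ℕ
    res-<   : ∀ n → res n < 3 ^ n
    res-coh : ∀ n → res (suc n) mod3^ n ≡ res n
open ℤ₃ public

_≈₃_ : ℤ₃ → ℤ₃ → Set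
x ≈₃ y = ∀ n → res x n ≡ res y n

private
  coh : (f : ℕ → ℕ → ℕ) →
        (∀ a b d .{{_ : NonZero d}} → f a b % d ≡ f (a % d) (b % d) % d) →
        (x y : ℤ₃) → ∀ n →
        (f (res x (suc n)) (res y (suc n)) mod3^ (suc n)) mod3^ n
          ≡ f (res x n) (res y n) mod3^ n
  coh f dist x y n =
    trans (m∣n⇒o%n%m≡o%m (3 ^ n) (3 ^ suc n) _ {{nz n}} {{nz (suc n)}} (3^n∣3^suc n))
      (trans (dist (res x (suc n)) (res y (suc n)) (3 ^ n) {{nz n}})
        (cong₂ (λ u v → f u v mod3^ n) (res-coh x n) (res-coh y n)))

infixl 6 _+₃_
infixl 7 _*₃_

_+₃_ : ℤ₃ → ℤ₃ → ℤ₃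
x +₃ y = mkℤ₃ (λ n → (res x n + res y n) mod3^ n)
               (λ n → m%n<n _ (3 ^ n) {{nz n}})
               (coh _+_ (λ a b d → %-distribˡ-+ a b d) x y)

_*₃_ : ℤ₃ → ℤ₃ → ℤ₃
x *₃ y = mkℤ₃ (λ n → (res x n * res y n) mod3^ n)
               (λ n → m%n<n _ (3 ^ n) {{nz n}})
               (coh _*_ (λ a b d → %-distribˡ-* a b d) x y)

IsSquare₃ : ℤ₃ → Set
IsSquare₃ z = Σ ℤ₃ (λ x → (x *₃ x) ≈₃ z)

red3 : ℤ₃ → ℕ
red3 x = res x 1

legendre3ℕ : ℕ → ℤ
legendre3ℕ zero = + 0
legendre3ℕ (suc zero) = + 1
legendre3ℕ (suc (suc _)) = -[1+ 0 ]

legendre3 : ℤ₃ → ℤ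
legendre3 x = legendre3ℕ (red3 x)

{-# OPTIONS --safe #-}
module Submission where

-- Modulo 3 the units are ±1 and the only nonzero square is 1. If a, b, c were all
-- units, two of them would have the same residue, so their product is ≡ 1 and,
-- since r ≡ 1, the corresponding ab + r is ≡ 2 — a non-square modulo 3.

open import Defs
open import Data.Nat using (suc; s≤s; _*_; _+_; _%_; _<_; _≟_)
open import Data.Integer using (+_)
open import Data.Sum using (_⊎_; inj₁; inj₂; [_,_])
open import Data.Product using (_,_)
open import Data.Empty using (⊥-elim)
open import Function using (_∘_)
open import Relation.Nullary using (yes; no)
open import Relation.Binary.PropositionalEquality using (_≡_; _≢_; refl; sym; trans; cong; cong₂)

unit-mod3 : ∀ {u} → u < 3 → u ≢ 0 → u ≡ 1 ⊎ u ≡ 2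
unit-mod3 {0} _ u≢0 = ⊥-elim (u≢0 refl)
unit-mod3 {1} _ _ = inj₁ refl
unit-mod3 {2} _ _ = inj₂ refl
unit-mod3 {suc (suc (suc _))} (s≤s (s≤s (s≤s ()))) _

unit²-mod3≡1 : ∀ {u} → u < 3 → u ≢ 0 → (u * u) % 3 ≡ 1
unit²-mod3≡1 u<3 u≢0 with unit-mod3 u<3 u≢0
... | inj₁ refl = refl
... | inj₂ refl = refl

square-mod3≢2 : ∀ {u} → u < 3 → (u * u) % 3 ≢ 2
square-mod3≢2 {0} _ ()
square-mod3≢2 {1} _ ()
square-mod3≢2 {2} _ ()
square-mod3≢2 {suc (suc (suc _))} (s≤s (s≤s (s≤s ())))

units-mod3-collide : ∀ {u v w} → u < 3 → v < 3 → w < 3 → u ≢ 0 → v ≢ 0 → w ≢ 0 →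
                     u ≡ v ⊎ v ≡ w ⊎ u ≡ w
units-mod3-collide u<3 v<3 w<3 u≢0 v≢0 w≢0
  with unit-mod3 u<3 u≢0 | unit-mod3 v<3 v≢0 | unit-mod3 w<3 w≢0
... | inj₁ refl | inj₁ refl | _         = inj₁ refl
... | inj₂ refl | inj₂ refl | _         = inj₁ refl
... | _         | inj₁ refl | inj₁ refl = inj₂ (inj₁ refl)
... | _         | inj₂ refl | inj₂ refl = inj₂ (inj₁ refl)
... | inj₁ refl | inj₂ refl | inj₁ refl = inj₂ (inj₂ refl)
... | inj₂ refl | inj₁ refl | inj₂ refl = inj₂ (inj₂ refl)

red3-< : (x : ℤ₃) → red3 x < 3
red3-< x = res-< x 1

legendre3≡1⇒red3≡1 : (r : ℤ₃) → legendre3 r ≡ + 1 → red3 r ≡ 1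
legendre3≡1⇒red3≡1 r legendre≡1 with red3 r | legendre≡1
... | 1           | _  = refl
... | 0           | ()
... | suc (suc _) | ()

square-red3≢2 : {z : ℤ₃} → IsSquare₃ z → red3 z ≢ 2
square-red3≢2 (x , x²≈z) = square-mod3≢2 (red3-< x) ∘ trans (x²≈z 1)

-- red3 (x *₃ y) and red3 (x +₃ y) reduce definitionally to the residues combined mod 3.
red3-*₃-equal-units : (x y : ℤ₃) → red3 x ≢ 0 → red3 x ≡ red3 y → red3 (x *₃ y) ≡ 1
red3-*₃-equal-units x y x≢0 x≡y =
  trans (cong (λ v → (red3 x * v) % 3) (sym x≡y)) (unit²-mod3≡1 (red3-< x) x≢0)

red3-equal-units-*₃+₃≡2 : (r : ℤ₃) → red3 r ≡ 1 → (x y : ℤ₃) →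
  red3 x ≢ 0 → red3 x ≡ red3 y → red3 (x *₃ y +₃ r) ≡ 2
red3-equal-units-*₃+₃≡2 r r≡1 x y x≢0 x≡y =
  cong₂ (λ u v → (u + v) % 3) (red3-*₃-equal-units x y x≢0 x≡y) r≡1

lemma4p2 : (r : ℤ₃) → legendre3 r ≡ + 1 →
    (a b c : ℤ₃) →
    IsSquare₃ (a *₃ b +₃ r) → IsSquare₃ (b *₃ c +₃ r) → IsSquare₃ (a *₃ c +₃ r) →
    red3 a ≡ 0 ⊎ red3 b ≡ 0 ⊎ red3 c ≡ 0
lemma4p2 r legendre≡1 a b c ab+r² bc+r² ac+r²
  with red3 a ≟ 0 | red3 b ≟ 0 | red3 c ≟ 0
... | yes a≡0 | _       | _       = inj₁ a≡0
... | no _    | yes b≡0 | _       = inj₂ (inj₁ b≡0)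
... | no _    | no _    | yes c≡0 = inj₂ (inj₂ c≡0)
... | no a≢0  | no b≢0  | no c≢0  = ⊥-elim
  ([ excluded a b ab+r² a≢0 , [ excluded b c bc+r² b≢0 , excluded a c ac+r² a≢0 ] ]
     (units-mod3-collide (red3-< a) (red3-< b) (red3-< c) a≢0 b≢0 c≢0))
  where
  excluded : (x y : ℤ₃) → IsSquare₃ (x *₃ y +₃ r) → red3 x ≢ 0 → red3 x ≢ red3 y
  excluded x y xy+r² x≢0 x≡y =
    square-red3≢2 {x *₃ y +₃ r} xy+r²
      (red3-equal-units-*₃+₃≡2 r (legendre3≡1⇒red3≡1 r legendre≡1) x y x≢0 x≡y)
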